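{- Let $G$ be an undirected graph and $X\subseteq V(G)$. If $X$ is $3\phi$-vertex-expanding in $G$, then $X$ is $\phi$-tough in $G$.
   Context: A vertex cut $(L,S,R)$ of $G$ is a partition of $V(G)$ with $L,R\neq\emptyset$ and no edge between $L$ and $R$; $X$ is $\psi$-vertex-expanding in $G$ if for every vertex cut $(L,S,R)$, $|S|\ge\psi\min\{|X\cap(L\cup S)|,|X\cap(R\cup S)|\}$. For a graph $H$ and $X\subseteq V(H)$, $c_H(X)$ is the number of connected components of $H$ that contain at least one vertex of $X$. $X$ is $\phi$-tough in $G$ if for every $S\subseteq V(G)$ with $c_{G-S}(X)>1$, we have $|S|\ge\phi\cdot c_{G-S}(X)$.
   Formalization: The parameter φ, and with it the expansion parameter $3\phi$, ranges over the rationals. -}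

module Defs where

open import Data.Nat using (ℕ; _<_) renaming (_⊓_ to _⊓ℕ_)
open import Data.Fin using (Fin)
open import Data.Fin.Subset using (Subset; _∈_; _∉_; _∩_; _∪_; ∣_∣; Nonempty)
open import Data.Integer using (+_)
open import Data.Rational using (ℚ; _/_; _*_; _≤_)
open import Data.Product using (_×_; ∃)
open import Data.Sum using (_⊎_)
open import Relation.Nullary using (¬_)
open import Relation.Binary.PropositionalEquality using (_≡_)

record Graph (n : ℕ) : Set₁ where
  field
    Adj : Fin n → Fin n → Set
    sym : ∀ {u v} → Adj u v → Adj v u
open Graph public

⟦_⟧ : ℕ → ℚ
⟦ k ⟧ = (+ k) / 1

record VertexCut {n : ℕ} (G : Graph n) (L S R : Subset n) : Set where
  field
    cover    : ∀ v → v ∈ L ⊎ (v ∈ S ⊎ v ∈ R)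
    disjLS   : ∀ v → v ∈ L → v ∉ S
    disjLR   : ∀ v → v ∈ L → v ∉ R
    disjSR   : ∀ v → v ∈ S → v ∉ R
    L-ne     : Nonempty L
    R-ne     : Nonempty R
    noEdge   : ∀ u v → u ∈ L → v ∈ R → ¬ Adj G u v

VertexExpanding : {n : ℕ} → Graph n → Subset n → ℚ → Set
VertexExpanding G X ψ =
  ∀ L S R → VertexCut G L S R →
    ψ * ⟦ ∣ X ∩ (L ∪ S) ∣ ⊓ℕ ∣ X ∩ (R ∪ S) ∣ ⟧ ≤ ⟦ ∣ S ∣ ⟧

data Reach {n : ℕ} (G : Graph n) (S : Subset n) (u : Fin n) : Fin n → Set where
  here : u ∉ S → Reach G S u u
  step : ∀ {v w} → Reach G S u v → Adj G v w → w ∉ S → Reach G S u w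

-- CompCount G S X k : c_{G-S}(X) = k, i.e. the connected components of
-- G - S containing a vertex of X admit k representatives: each in X \ S,
-- pairwise in distinct components, and every vertex of X \ S lies in the
-- component of one of them.
record CompCount {n : ℕ} (G : Graph n) (S X : Subset n) (k : ℕ) : Set where
  field
    rep      : Fin k → Fin n
    rep-X    : ∀ i → rep i ∈ X
    rep-S    : ∀ i → rep i ∉ S
    distinct : ∀ i j → Reach G S (rep i) (rep j) → i ≡ j
    covers   : ∀ x → x ∈ X → x ∉ S → ∃ λ i → Reach G S (rep i) x

Tough : {n : ℕ} → Graph n → Subset n → ℚ → Set
Tough G X φ =
  ∀ S k → CompCount G S X k → 1 < k → φ * ⟦ k ⟧ ≤ ⟦ ∣ S ∣ ⟧

{-# OPTIONS --safe #-}
-- If S leaves k ≥ 2 components of G - S meeting X, let L be the union of the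
-- first ⌊k/2⌋ of them and R the rest of G - S. Then (L,S,R) is a vertex cut,
-- and both X ∩ (L ∪ S) and X ∩ (R ∪ S) contain a representative of at least
-- ⌊k/2⌋ components, so expansion gives |S| ≥ 3φ⌊k/2⌋ ≥ φk.
module Submission where

open import Defs hiding (sym)
open import Level using (0ℓ)
open import Data.Nat as ℕ using (ℕ; zero; suc; z≤n; s≤s; ⌊_/2⌋; ⌈_/2⌉; _⊓_)
import Data.Nat.Properties as ℕP
import Data.Nat.Coprimality as Coprime
open import Data.Integer as ℤ using (+_)
import Data.Integer.Properties as ℤP
open import Data.Rational as ℚ using (ℚ; mkℚ; _*_; _≤_; 0ℚ; NonNegative)
import Data.Rational.Properties as ℚP
import Data.Rational.Unnormalised as ℚᵘ
open import Data.Fin using (Fin; zero; suc; _↑ˡ_; _↑ʳ_; splitAt)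
open import Data.Fin.Properties
  using (∀-cons; any?; suc-injective; 0≢1+n; ↑ˡ-injective; ↑ʳ-injective; splitAt-↑ˡ; splitAt-↑ʳ)
open import Data.Fin.Subset using (Subset; _∈_; _∉_; _-_; ∣_∣; _∩_; _∪_)
open import Data.Fin.Subset.Properties using (_∈?_; x∈p∩q⁺; x∈p∪q⁺; x∈p∧x≢y⇒x∈p-y; x∈p⇒∣p-x∣<∣p∣)
open import Data.Vec using (tabulate)
open import Data.Vec.Properties using (lookup∘tabulate; lookup⇒[]=; []=⇒lookup)
open import Data.Product using (∃; _×_; _,_; proj₁; proj₂)
open import Data.Sum using (inj₁; inj₂; _⊎_)
open import Function using (_∘_; Injective)
open import Relation.Nullary using (Dec; yes; no; does; ¬_; ¬?)
open import Relation.Nullary.Decidable using (_×-dec_; dec-true; decidable-stable; ¬¬-excluded-middle)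
open import Relation.Unary using (Pred; Decidable)
open import Relation.Binary.PropositionalEquality using (_≡_; _≢_; sym; trans; cong; subst)

ι : ℕ → ℚ
ι k = mkℚ (+ k) 0 (Coprime.sym (Coprime.1-coprimeTo k))

⟦⟧≡ι : ∀ k → ⟦ k ⟧ ≡ ι k
⟦⟧≡ι k = ℚP.normalize-coprime _

⟦⟧-nonNeg : ∀ k → NonNegative ⟦ k ⟧
⟦⟧-nonNeg k = ℚP.normalize-nonNeg k 1

⟦⟧-mono-≤ : ∀ {m n} → m ℕ.≤ n → ⟦ m ⟧ ≤ ⟦ n ⟧
⟦⟧-mono-≤ {m} {n} m≤n rewrite ⟦⟧≡ι m | ⟦⟧≡ι n =
  ℚ.*≤* (ℤP.*-monoʳ-≤-nonNeg (+ 1) (ℤ.+≤+ m≤n))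

⟦⟧-homo-* : ∀ m n → ⟦ m ℕ.* n ⟧ ≡ ⟦ m ⟧ * ⟦ n ⟧
⟦⟧-homo-* m n rewrite ⟦⟧≡ι (m ℕ.* n) | ⟦⟧≡ι m | ⟦⟧≡ι n =
  ℚP.toℚᵘ-injective (ℚᵘP.≃-trans (ℚᵘ.*≡* (cong (ℤ._* + 1) (ℤP.pos-* m n)))
                                 (ℚᵘP.≃-sym (ℚP.toℚᵘ-homo-* (ι m) (ι n))))
  where import Data.Rational.Unnormalised.Properties as ℚᵘP

-- For φ < 0 the conclusion holds trivially since ⟦ s ⟧ ≥ 0.
≤-scale : ∀ c φ {k m s} → k ℕ.≤ c ℕ.* m → (⟦ c ⟧ * φ) * ⟦ m ⟧ ≤ ⟦ s ⟧ → φ * ⟦ k ⟧ ≤ ⟦ s ⟧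
≤-scale c φ {k} {m} {s} k≤cm cφm≤s with ℚP.≤-total 0ℚ φ
... | inj₁ 0≤φ = begin
  φ * ⟦ k ⟧           ≤⟨ ℚP.*-monoˡ-≤-nonNeg φ {{ℚ.nonNegative 0≤φ}} (⟦⟧-mono-≤ k≤cm) ⟩
  φ * ⟦ c ℕ.* m ⟧     ≡⟨ cong (φ *_) (⟦⟧-homo-* c m) ⟩
  φ * (⟦ c ⟧ * ⟦ m ⟧) ≡⟨ sym (ℚP.*-assoc φ ⟦ c ⟧ ⟦ m ⟧) ⟩
  (φ * ⟦ c ⟧) * ⟦ m ⟧ ≡⟨ cong (_* ⟦ m ⟧) (ℚP.*-comm φ ⟦ c ⟧) ⟩
  (⟦ c ⟧ * φ) * ⟦ m ⟧ ≤⟨ cφm≤s ⟩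
  ⟦ s ⟧               ∎
  where open ℚP.≤-Reasoning
... | inj₂ φ≤0 = begin
  φ * ⟦ k ⟧  ≤⟨ ℚP.*-monoʳ-≤-nonNeg ⟦ k ⟧ {{⟦⟧-nonNeg k}} φ≤0 ⟩
  0ℚ * ⟦ k ⟧ ≡⟨ ℚP.*-zeroˡ ⟦ k ⟧ ⟩
  0ℚ         ≤⟨ ℚP.nonNegative⁻¹ ⟦ s ⟧ {{⟦⟧-nonNeg s}} ⟩
  ⟦ s ⟧      ∎
  where open ℚP.≤-Reasoning

n≤3⌊n/2⌋ : ∀ {n} → 2 ℕ.≤ n → n ℕ.≤ 3 ℕ.* ⌊ n /2⌋
n≤3⌊n/2⌋ {0} ()
n≤3⌊n/2⌋ {1} (s≤s ())
n≤3⌊n/2⌋ {2} _ = ℕP.n≤1+n 2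
n≤3⌊n/2⌋ {3} _ = ℕP.≤-refl
n≤3⌊n/2⌋ {suc (suc n@(suc (suc _)))} _ = begin
  2 ℕ.+ n             ≤⟨ ℕP.+-mono-≤ (ℕP.n≤1+n 2) (n≤3⌊n/2⌋ (s≤s (s≤s z≤n))) ⟩
  3 ℕ.+ 3 ℕ.* ⌊ n /2⌋ ≡⟨ sym (ℕP.*-suc 3 ⌊ n /2⌋) ⟩
  3 ℕ.* suc ⌊ n /2⌋   ∎
  where open ℕP.≤-Reasoning

↑ˡ≢↑ʳ : ∀ {m n} (i : Fin m) (j : Fin n) → i ↑ˡ n ≢ m ↑ʳ j
↑ˡ≢↑ʳ {m} {n} i j e with trans (sym (splitAt-↑ˡ m i n)) (trans (cong (splitAt m) e) (splitAt-↑ʳ m n j))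
... | ()

¬¬-∀-Fin : ∀ {m p} {P : Pred (Fin m) p} → (∀ i → ¬ ¬ P i) → ¬ ¬ (∀ i → P i)
¬¬-∀-Fin {zero}  _   k = k λ ()
¬¬-∀-Fin {suc m} ¬¬P k = ¬¬P zero λ P0 → ¬¬-∀-Fin (¬¬P ∘ suc) (k ∘ ∀-cons P0)

¬¬-decidable : ∀ {m n} (R : Fin m → Fin n → Set) → ¬ ¬ (∀ u v → Dec (R u v))
¬¬-decidable R = ¬¬-∀-Fin λ u → ¬¬-∀-Fin λ v → ¬¬-excluded-middle

fromDec : ∀ {n ℓ} {P : Pred (Fin n) ℓ} → Decidable P → Subset n
fromDec P? = tabulate (does ∘ P?)

module _ {n ℓ} {P : Pred (Fin n) ℓ} (P? : Decidable P) where

  ∈-fromDec⁺ : ∀ {x} → P x → x ∈ fromDec P?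
  ∈-fromDec⁺ {x} px = lookup⇒[]= x _ (trans (lookup∘tabulate _ x) (dec-true (P? x) px))

  ∈-fromDec⁻ : ∀ {x} → x ∈ fromDec P? → P x
  ∈-fromDec⁻ {x} x∈ with P? x | trans (sym (lookup∘tabulate _ x)) ([]=⇒lookup x∈)
  ... | yes px | _  = px
  ... | no _   | ()

injection⇒≤∣p∣ : ∀ {m n} (p : Subset n) (f : Fin m → Fin n) →
  Injective _≡_ _≡_ f → (∀ i → f i ∈ p) → m ℕ.≤ ∣ p ∣
injection⇒≤∣p∣ {zero}  p f f-inj f∈p = z≤n
injection⇒≤∣p∣ {suc m} p f f-inj f∈p =
  ℕP.≤-trans (s≤s (injection⇒≤∣p∣ (p - f zero) (f ∘ suc) (suc-injective ∘ f-inj) f∘suc∈p-f0))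
             (x∈p⇒∣p-x∣<∣p∣ (f∈p zero))
  where
  f∘suc∈p-f0 : ∀ i → f (suc i) ∈ p - f zero
  f∘suc∈p-f0 i = x∈p∧x≢y⇒x∈p-y (f∈p (suc i)) (λ e → 0≢1+n (sym (f-inj e)))

reach-∉ : ∀ {n} {G : Graph n} {S u v} → Reach G S u v → v ∉ S
reach-∉ (here u∉S)     = u∉S
reach-∉ (step _ _ w∉S) = w∉S

module ComponentSplit {n} {G : Graph n} {S X : Subset n} {h r : ℕ}
  (comps : CompCount G S X (h ℕ.+ r)) (reach? : ∀ u v → Dec (Reach G S u v)) where

  open CompCount comps

  rep-injective : Injective _≡_ _≡_ rep
  rep-injective {i} {j} e = distinct i j (subst (Reach G S (rep i)) e (here (rep-S i)))

  InL : Pred (Fin n) 0ℓ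
  InL v = ∃ λ (i : Fin h) → Reach G S (rep (i ↑ˡ r)) v

  InR : Pred (Fin n) 0ℓ
  InR v = ¬ InL v × v ∉ S

  InL? : Decidable InL
  InL? v = any? λ i → reach? (rep (i ↑ˡ r)) v

  InR? : Decidable InR
  InR? v = ¬? (InL? v) ×-dec ¬? (v ∈? S)

  L R : Subset n
  L = fromDec InL?
  R = fromDec InR?

  right-rep-∉L : ∀ j → ¬ InL (rep (h ↑ʳ j))
  right-rep-∉L j (i , reach) = ↑ˡ≢↑ʳ i j (distinct _ _ reach)

  cover : ∀ v → v ∈ L ⊎ (v ∈ S ⊎ v ∈ R)
  cover v with InL? v | v ∈? S
  ... | yes inL | _       = inj₁ (∈-fromDec⁺ InL? inL)
  ... | no ∉L   | yes v∈S = inj₂ (inj₁ v∈S)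
  ... | no ∉L   | no v∉S  = inj₂ (inj₂ (∈-fromDec⁺ InR? (∉L , v∉S)))

  cut : Fin h → Fin r → VertexCut G L S R
  cut i j = record
    { cover  = cover
    ; disjLS = λ v v∈L → reach-∉ (proj₂ (∈-fromDec⁻ InL? v∈L))
    ; disjLR = λ v v∈L v∈R → proj₁ (∈-fromDec⁻ InR? v∈R) (∈-fromDec⁻ InL? v∈L)
    ; disjSR = λ v v∈S v∈R → proj₂ (∈-fromDec⁻ InR? v∈R) v∈S
    ; L-ne   = rep (i ↑ˡ r) , ∈-fromDec⁺ InL? (i , here (rep-S _))
    ; R-ne   = rep (h ↑ʳ j) , ∈-fromDec⁺ InR? (right-rep-∉L j , rep-S _)
    ; noEdge = λ u v u∈L v∈R adj →
        let (i , reach) = ∈-fromDec⁻ InL? u∈L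
            (∉L , v∉S)  = ∈-fromDec⁻ InR? v∈R
        in ∉L (i , step reach adj v∉S)
    }

  h≤∣X∩[L∪S]∣ : h ℕ.≤ ∣ X ∩ (L ∪ S) ∣
  h≤∣X∩[L∪S]∣ = injection⇒≤∣p∣ _ (rep ∘ (_↑ˡ r)) (↑ˡ-injective r _ _ ∘ rep-injective)
    λ i → x∈p∩q⁺ (rep-X _ , x∈p∪q⁺ (inj₁ (∈-fromDec⁺ InL? (i , here (rep-S _)))))

  r≤∣X∩[R∪S]∣ : r ℕ.≤ ∣ X ∩ (R ∪ S) ∣
  r≤∣X∩[R∪S]∣ = injection⇒≤∣p∣ _ (rep ∘ (h ↑ʳ_)) (↑ʳ-injective h _ _ ∘ rep-injective)
    λ j → x∈p∩q⁺ (rep-X _ , x∈p∪q⁺ (inj₁ (∈-fromDec⁺ InR? (right-rep-∉L j , rep-S _))))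

expanding⇒toughness-bound : ∀ {n} {G : Graph n} {X S : Subset n} {φ} k →
  VertexExpanding G X (⟦ 3 ⟧ * φ) → (∀ u v → Dec (Reach G S u v)) →
  CompCount G S X (2 ℕ.+ k) → φ * ⟦ 2 ℕ.+ k ⟧ ≤ ⟦ ∣ S ∣ ⟧
expanding⇒toughness-bound {G = G} {X} {S} {φ} k expanding reach? comps =
  ≤-scale 3 φ {m = ∣ X ∩ (L ∪ S) ∣ ⊓ ∣ X ∩ (R ∪ S) ∣} {s = ∣ S ∣}
    (ℕP.≤-trans (n≤3⌊n/2⌋ (s≤s (s≤s z≤n))) (ℕP.*-monoʳ-≤ 3 ⌊k/2⌋≤min))
    (expanding L S R (cut zero zero))
  where
  halves : CompCount G S X (⌊ 2 ℕ.+ k /2⌋ ℕ.+ ⌈ 2 ℕ.+ k /2⌉)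
  halves = subst (CompCount G S X) (sym (ℕP.⌊n/2⌋+⌈n/2⌉≡n (2 ℕ.+ k))) comps

  open ComponentSplit {h = ⌊ 2 ℕ.+ k /2⌋} {r = ⌈ 2 ℕ.+ k /2⌉} halves reach?

  ⌊k/2⌋≤min : ⌊ 2 ℕ.+ k /2⌋ ℕ.≤ ∣ X ∩ (L ∪ S) ∣ ⊓ ∣ X ∩ (R ∪ S) ∣
  ⌊k/2⌋≤min = ℕP.⊓-glb h≤∣X∩[L∪S]∣ (ℕP.≤-trans (ℕP.⌊n/2⌋≤⌈n/2⌉ (2 ℕ.+ k)) r≤∣X∩[R∪S]∣)

-- Reachability in G - S is not decidable constructively, but the bound is, so
-- we may argue under the double negation of its decidability.
mainTheorem11 : (n : ℕ) (G : Graph n) (X : Subset n) (φ : ℚ) →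
    VertexExpanding G X (⟦ 3 ⟧ * φ) → Tough G X φ
mainTheorem11 n G X φ expanding S 1 comps (s≤s ())
mainTheorem11 n G X φ expanding S (suc (suc k)) comps _ =
  decidable-stable (φ * ⟦ 2 ℕ.+ k ⟧ ℚ.≤? ⟦ ∣ S ∣ ⟧) λ bound-fails →
    ¬¬-decidable (Reach G S) λ reach? →
      bound-fails (expanding⇒toughness-bound {φ = φ} k expanding reach? comps)
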